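{- If $C_1, C_2, C_3$ are $3\times3\times3$ cubes in $[4]^3$, then the set of points lying in $C_i \cap C_j$ for some $i \ne j$ has at least $20$ elements.
   Context: $[4] = \{0,1,2,3\}$. A $3\times3\times3$ cube in $[4]^3$ is a set of the form $A \times B \times C$ with $A,B,C \subseteq [4]$ each of size $3$. -}

module Defs where

open import Data.Nat using (ℕ)
open import Data.Fin using (Fin)
open import Data.Fin.Subset using (Subset; _∈_; ∣_∣)
open import Data.Fin.Subset.Properties using (_∈?_)
open import Data.Product using (_×_; _,_)
open import Data.Sum using (_⊎_)
open import Data.List using (List; length; filter; cartesianProduct; allFin)
open import Relation.Binary.PropositionalEquality using (_≡_)
open import Relation.Nullary using (Dec)
open import Relation.Nullary.Decidable using (_×-dec_; _⊎-dec_)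

-- [4] = {0,1,2,3} is Fin 4; a point of [4]^3
Point : Set
Point = Fin 4 × Fin 4 × Fin 4

record Cube : Set where
  constructor cube
  field
    A B C : Subset 4
    ∣A∣≡3 : ∣ A ∣ ≡ 3
    ∣B∣≡3 : ∣ B ∣ ≡ 3
    ∣C∣≡3 : ∣ C ∣ ≡ 3

open Cube public

_∈ᶜ_ : Point → Cube → Set
(x , y , z) ∈ᶜ K = x ∈ A K × y ∈ B K × z ∈ C K

_∈ᶜ?_ : (p : Point) (K : Cube) → Dec (p ∈ᶜ K)
(x , y , z) ∈ᶜ? K = (x ∈? A K) ×-dec ((y ∈? B K) ×-dec (z ∈? C K))

InTwo : Cube → Cube → Cube → Point → Set
InTwo K₁ K₂ K₃ p =
  (p ∈ᶜ K₁ × p ∈ᶜ K₂) ⊎ ((p ∈ᶜ K₁ × p ∈ᶜ K₃) ⊎ (p ∈ᶜ K₂ × p ∈ᶜ K₃))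

InTwo? : (K₁ K₂ K₃ : Cube) (p : Point) → Dec (InTwo K₁ K₂ K₃ p)
InTwo? K₁ K₂ K₃ p =
  ((p ∈ᶜ? K₁) ×-dec (p ∈ᶜ? K₂)) ⊎-dec
  (((p ∈ᶜ? K₁) ×-dec (p ∈ᶜ? K₃)) ⊎-dec ((p ∈ᶜ? K₂) ×-dec (p ∈ᶜ? K₃)))

allPoints : List Point
allPoints = cartesianProduct (allFin 4) (cartesianProduct (allFin 4) (allFin 4))

doubleCount : Cube → Cube → Cube → ℕ
doubleCount K₁ K₂ K₃ = length (filter (InTwo? K₁ K₂ K₃) allPoints)

-- The indicator of lying in at least two of three sets is [C₁∩C₂] + [C₁∩C₃] + [C₂∩C₃] − 2[C₁∩C₂∩C₃],
-- so the number of such points is the sum of the pairwise intersection sizes minus twice the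
-- triple one. Intersections of boxes are boxes,
-- of size the product of one size per axis. A 3-subset of [4] is the complement of a single
-- coordinate, so on each axis these sizes only depend on which of the three omitted coordinates
-- coincide; of the 5³ combinations of such patterns, the smallest count is 20, reached when on
-- each axis a different pair of cubes omits a common coordinate.
module Submission where

open import Defs
open import Algebra.Bundles using (CommutativeMonoid)
open import Data.Bool using (Bool; true; false; _∧_; _∨_)
open import Data.Bool.Properties using (∧-commutativeMonoid)
open import Data.Fin using (Fin; zero; suc)
open import Data.Fin.Properties using (all?)
open import Data.Fin.Subset using (Subset; inside; outside; _∩_; ∁; ⁅_⁆; ∣_∣; ⊥; ⊤)
open import Data.Fin.Subset.Properties using (_∈?_; ∣p∣≡n⇒p≡⊤)
open import Data.List using (List; []; _∷_; _++_; map; length; filter; cartesianProduct; allFin; tabulate)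
open import Data.List.Properties using (map-tabulate)
open import Data.List.Membership.Propositional using () renaming (_∈_ to _∈ˡ_)
open import Data.List.Relation.Unary.All as All using (All)
open import Data.Nat using (ℕ; zero; suc; _+_; _*_; _≤_; _≤?_; _≟_)
open import Data.Nat.Properties
  using (suc-injective; +-assoc; *-identityˡ; *-zeroʳ; *-distribʳ-+; *-distribˡ-+; +-cancelʳ-≤; ≤-trans; ≤-reflexive; +-commutativeSemigroup)
open import Data.Vec using ([]; _∷_)
open import Data.Product using (_×_; _,_; ∃-syntax)
open import Data.Product.Properties using (≡-dec)
open import Function using (_∘_; id)
open import Relation.Binary.PropositionalEquality using (_≡_; refl; sym; trans; cong; cong₂; module ≡-Reasoning)
open import Relation.Binary.Definitions using (DecidableEquality)
open import Relation.Nullary using (does)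
open import Relation.Nullary.Decidable using (from-yes)
open import Relation.Unary using (Decidable)

open import Algebra.Properties.CommutativeSemigroup +-commutativeSemigroup
  using () renaming (interchange to +-interchange)
open import Algebra.Properties.CommutativeSemigroup (CommutativeMonoid.commutativeSemigroup ∧-commutativeMonoid)
  using () renaming (interchange to ∧-interchange)

open ≡-Reasoning

χ : Bool → ℕ
χ true  = 1
χ false = 0

χ-∧ : (a b : Bool) → χ (a ∧ b) ≡ χ a * χ b
χ-∧ true  b = sym (*-identityˡ (χ b))
χ-∧ false b = refl

sumBy : {X : Set} → (X → ℕ) → List X → ℕ
sumBy f []       = 0
sumBy f (x ∷ xs) = f x + sumBy f xs

module _ {X : Set} where

  sumBy-cong : {f g : X → ℕ} → (∀ x → f x ≡ g x) → ∀ xs → sumBy f xs ≡ sumBy g xs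
  sumBy-cong f≗g []       = refl
  sumBy-cong f≗g (x ∷ xs) = cong₂ _+_ (f≗g x) (sumBy-cong f≗g xs)

  sumBy-++ : (f : X → ℕ) (xs ys : List X) → sumBy f (xs ++ ys) ≡ sumBy f xs + sumBy f ys
  sumBy-++ f []       ys = refl
  sumBy-++ f (x ∷ xs) ys = trans (cong (f x +_) (sumBy-++ f xs ys)) (sym (+-assoc (f x) _ _))

  sumBy-map : {Y : Set} (f : Y → ℕ) (g : X → Y) (xs : List X) → sumBy f (map g xs) ≡ sumBy (f ∘ g) xs
  sumBy-map f g []       = refl
  sumBy-map f g (x ∷ xs) = cong (f (g x) +_) (sumBy-map f g xs)

  sumBy-+ : (f g : X → ℕ) (xs : List X) → sumBy (λ x → f x + g x) xs ≡ sumBy f xs + sumBy g xs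
  sumBy-+ f g []       = refl
  sumBy-+ f g (x ∷ xs) =
    trans (cong (f x + g x +_) (sumBy-+ f g xs)) (+-interchange (f x) (g x) (sumBy f xs) (sumBy g xs))

  sumBy-*ˡ : (c : ℕ) (f : X → ℕ) (xs : List X) → sumBy (λ x → c * f x) xs ≡ c * sumBy f xs
  sumBy-*ˡ c f []       = sym (*-zeroʳ c)
  sumBy-*ˡ c f (x ∷ xs) = trans (cong (c * f x +_) (sumBy-*ˡ c f xs)) (sym (*-distribˡ-+ c (f x) _))

  length-filter≡sumBy : {P : X → Set} (P? : Decidable P) (xs : List X) →
                        length (filter P? xs) ≡ sumBy (χ ∘ does ∘ P?) xs
  length-filter≡sumBy P? []       = refl
  length-filter≡sumBy P? (x ∷ xs) with does (P? x)
  ... | true  = cong suc (length-filter≡sumBy P? xs)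
  ... | false = length-filter≡sumBy P? xs

infixr 7 _⊗_
_⊗_ : {X Y : Set} → (X → ℕ) → (Y → ℕ) → X × Y → ℕ
(f ⊗ g) (x , y) = f x * g y

module _ {X Y : Set} (f : X → ℕ) (g : Y → ℕ) where

  sumBy-cartesianProduct : (xs : List X) (ys : List Y) →
                           sumBy (f ⊗ g) (cartesianProduct xs ys) ≡ sumBy f xs * sumBy g ys
  sumBy-cartesianProduct []       ys = refl
  sumBy-cartesianProduct (x ∷ xs) ys = begin
    sumBy (f ⊗ g) (map (x ,_) ys ++ cartesianProduct xs ys)
      ≡⟨ sumBy-++ (f ⊗ g) (map (x ,_) ys) (cartesianProduct xs ys) ⟩
    sumBy (f ⊗ g) (map (x ,_) ys) + sumBy (f ⊗ g) (cartesianProduct xs ys)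
      ≡⟨ cong₂ _+_ (sumBy-map (f ⊗ g) (x ,_) ys) (sumBy-cartesianProduct xs ys) ⟩
    sumBy (λ y → f x * g y) ys + sumBy f xs * sumBy g ys
      ≡⟨ cong (_+ sumBy f xs * sumBy g ys) (sumBy-*ˡ (f x) g ys) ⟩
    f x * sumBy g ys + sumBy f xs * sumBy g ys
      ≡⟨ *-distribʳ-+ (sumBy g ys) (f x) (sumBy f xs) ⟨
    (f x + sumBy f xs) * sumBy g ys
      ∎

∈?-∩ : {n : ℕ} (x : Fin n) (p q : Subset n) → does (x ∈? p ∩ q) ≡ does (x ∈? p) ∧ does (x ∈? q)
∈?-∩ zero    (inside  ∷ p) (inside  ∷ q) = refl
∈?-∩ zero    (inside  ∷ p) (outside ∷ q) = refl
∈?-∩ zero    (outside ∷ p) (_       ∷ q) = refl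
∈?-∩ (suc x) (_       ∷ p) (_       ∷ q) = ∈?-∩ x p q

𝟙 : {n : ℕ} → Subset n → Fin n → ℕ
𝟙 p x = χ (does (x ∈? p))

sumBy-𝟙 : {n : ℕ} (p : Subset n) → sumBy (𝟙 p) (allFin n) ≡ ∣ p ∣
sumBy-𝟙 []                = refl
sumBy-𝟙 {suc n} (s ∷ p) = begin
  𝟙 (s ∷ p) zero + sumBy (𝟙 (s ∷ p)) (tabulate suc)
    ≡⟨ cong (λ xs → 𝟙 (s ∷ p) zero + sumBy (𝟙 (s ∷ p)) xs) (map-tabulate id suc) ⟨
  𝟙 (s ∷ p) zero + sumBy (𝟙 (s ∷ p)) (map suc (allFin n))
    ≡⟨ cong (𝟙 (s ∷ p) zero +_) (sumBy-map (𝟙 (s ∷ p)) suc (allFin n)) ⟩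
  𝟙 (s ∷ p) zero + sumBy (𝟙 p) (allFin n)
    ≡⟨ cong (𝟙 (s ∷ p) zero +_) (sumBy-𝟙 p) ⟩
  𝟙 (s ∷ p) zero + ∣ p ∣
    ≡⟨ count-head s ⟩
  ∣ s ∷ p ∣
    ∎
  where
  count-head : ∀ s → 𝟙 (s ∷ p) zero + ∣ p ∣ ≡ ∣ s ∷ p ∣
  count-head inside  = refl
  count-head outside = refl

Box : Set
Box = Subset 4 × Subset 4 × Subset 4

box : Cube → Box
box K = A K , B K , C K

infixr 7 _∩ᵇ_
_∩ᵇ_ : Box → Box → Box
(p , q , r) ∩ᵇ (p′ , q′ , r′) = p ∩ p′ , q ∩ q′ , r ∩ r′

volume : Box → ℕ
volume (p , q , r) = ∣ p ∣ * (∣ q ∣ * ∣ r ∣)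

-- For X = box K this is definitionally  does (v ∈ᶜ? K).
infix 5 _∈ᵇ_
_∈ᵇ_ : Point → Box → Bool
(x , y , z) ∈ᵇ (p , q , r) = does (x ∈? p) ∧ (does (y ∈? q) ∧ does (z ∈? r))

𝟙ᵇ : Box → Point → ℕ
𝟙ᵇ X v = χ (v ∈ᵇ X)

∈ᵇ-∩ᵇ : (v : Point) (X Y : Box) → v ∈ᵇ (X ∩ᵇ Y) ≡ (v ∈ᵇ X) ∧ (v ∈ᵇ Y)
∈ᵇ-∩ᵇ (x , y , z) (p , q , r) (p′ , q′ , r′) = begin
  does (x ∈? p ∩ p′) ∧ (does (y ∈? q ∩ q′) ∧ does (z ∈? r ∩ r′))
    ≡⟨ cong₂ _∧_ (∈?-∩ x p p′) (cong₂ _∧_ (∈?-∩ y q q′) (∈?-∩ z r r′)) ⟩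
  (a ∧ a′) ∧ ((b ∧ b′) ∧ (c ∧ c′))
    ≡⟨ cong ((a ∧ a′) ∧_) (∧-interchange b b′ c c′) ⟩
  (a ∧ a′) ∧ ((b ∧ c) ∧ (b′ ∧ c′))
    ≡⟨ ∧-interchange a a′ (b ∧ c) (b′ ∧ c′) ⟩
  (a ∧ (b ∧ c)) ∧ (a′ ∧ (b′ ∧ c′))
    ∎
  where
  a b c a′ b′ c′ : Bool
  a = does (x ∈? p) ; b = does (y ∈? q) ; c = does (z ∈? r)
  a′ = does (x ∈? p′) ; b′ = does (y ∈? q′) ; c′ = does (z ∈? r′)

𝟙ᵇ≡𝟙⊗𝟙⊗𝟙 : (v : Point) (p q r : Subset 4) → 𝟙ᵇ (p , q , r) v ≡ (𝟙 p ⊗ 𝟙 q ⊗ 𝟙 r) v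
𝟙ᵇ≡𝟙⊗𝟙⊗𝟙 (x , y , z) p q r = begin
  χ (does (x ∈? p) ∧ (does (y ∈? q) ∧ does (z ∈? r)))    ≡⟨ χ-∧ (does (x ∈? p)) _ ⟩
  𝟙 p x * χ (does (y ∈? q) ∧ does (z ∈? r))             ≡⟨ cong (𝟙 p x *_) (χ-∧ (does (y ∈? q)) _) ⟩
  𝟙 p x * (𝟙 q y * 𝟙 r z)                               ∎

sumBy-𝟙ᵇ : (X : Box) → sumBy (𝟙ᵇ X) allPoints ≡ volume X
sumBy-𝟙ᵇ (p , q , r) = begin
  sumBy (𝟙ᵇ (p , q , r)) allPoints
    ≡⟨ sumBy-cong (λ v → 𝟙ᵇ≡𝟙⊗𝟙⊗𝟙 v p q r) allPoints ⟩
  sumBy (𝟙 p ⊗ 𝟙 q ⊗ 𝟙 r) allPoints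
    ≡⟨ sumBy-cartesianProduct (𝟙 p) (𝟙 q ⊗ 𝟙 r) (allFin 4) (cartesianProduct (allFin 4) (allFin 4)) ⟩
  sumBy (𝟙 p) (allFin 4) * sumBy (𝟙 q ⊗ 𝟙 r) (cartesianProduct (allFin 4) (allFin 4))
    ≡⟨ cong (sumBy (𝟙 p) (allFin 4) *_) (sumBy-cartesianProduct (𝟙 q) (𝟙 r) (allFin 4) (allFin 4)) ⟩
  sumBy (𝟙 p) (allFin 4) * (sumBy (𝟙 q) (allFin 4) * sumBy (𝟙 r) (allFin 4))
    ≡⟨ cong₂ _*_ (sumBy-𝟙 p) (cong₂ _*_ (sumBy-𝟙 q) (sumBy-𝟙 r)) ⟩
  ∣ p ∣ * (∣ q ∣ * ∣ r ∣)
    ∎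

χ-atLeastTwo : (u₁ u₂ u₃ : Bool) →
  χ ((u₁ ∧ u₂) ∨ ((u₁ ∧ u₃) ∨ (u₂ ∧ u₃))) + 2 * χ (u₁ ∧ (u₂ ∧ u₃)) ≡ χ (u₁ ∧ u₂) + χ (u₁ ∧ u₃) + χ (u₂ ∧ u₃)
χ-atLeastTwo true  true  true  = refl
χ-atLeastTwo true  true  false = refl
χ-atLeastTwo true  false true  = refl
χ-atLeastTwo true  false false = refl
χ-atLeastTwo false true  true  = refl
χ-atLeastTwo false true  false = refl
χ-atLeastTwo false false true  = refl
χ-atLeastTwo false false false = refl

module _ (K₁ K₂ K₃ : Cube) where

  private
    X₁ X₂ X₃ : Box
    X₁ = box K₁
    X₂ = box K₂
    X₃ = box K₃

  χInTwo : Point → ℕ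
  χInTwo v = χ (does (InTwo? K₁ K₂ K₃ v))

  χInTwo-inclusionExclusion : (v : Point) →
    χInTwo v + 2 * 𝟙ᵇ (X₁ ∩ᵇ X₂ ∩ᵇ X₃) v ≡ 𝟙ᵇ (X₁ ∩ᵇ X₂) v + 𝟙ᵇ (X₁ ∩ᵇ X₃) v + 𝟙ᵇ (X₂ ∩ᵇ X₃) v
  χInTwo-inclusionExclusion v = begin
    χInTwo v + 2 * 𝟙ᵇ (X₁ ∩ᵇ X₂ ∩ᵇ X₃) v
      ≡⟨ cong (λ b → χInTwo v + 2 * χ b)
              (trans (∈ᵇ-∩ᵇ v X₁ (X₂ ∩ᵇ X₃)) (cong (u₁ ∧_) (∈ᵇ-∩ᵇ v X₂ X₃))) ⟩
    χ ((u₁ ∧ u₂) ∨ ((u₁ ∧ u₃) ∨ (u₂ ∧ u₃))) + 2 * χ (u₁ ∧ (u₂ ∧ u₃))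
      ≡⟨ χ-atLeastTwo u₁ u₂ u₃ ⟩
    χ (u₁ ∧ u₂) + χ (u₁ ∧ u₃) + χ (u₂ ∧ u₃)
      ≡⟨ cong₂ _+_ (cong₂ _+_ (χ∩ X₁ X₂) (χ∩ X₁ X₃)) (χ∩ X₂ X₃) ⟨
    𝟙ᵇ (X₁ ∩ᵇ X₂) v + 𝟙ᵇ (X₁ ∩ᵇ X₃) v + 𝟙ᵇ (X₂ ∩ᵇ X₃) v
      ∎
    where
    u₁ u₂ u₃ : Bool
    u₁ = v ∈ᵇ X₁ ; u₂ = v ∈ᵇ X₂ ; u₃ = v ∈ᵇ X₃
    χ∩ : (X Y : Box) → 𝟙ᵇ (X ∩ᵇ Y) v ≡ χ ((v ∈ᵇ X) ∧ (v ∈ᵇ Y))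
    χ∩ X Y = cong χ (∈ᵇ-∩ᵇ v X Y)

  doubleCount-inclusionExclusion :
    doubleCount K₁ K₂ K₃ + 2 * volume (X₁ ∩ᵇ X₂ ∩ᵇ X₃)
      ≡ volume (X₁ ∩ᵇ X₂) + volume (X₁ ∩ᵇ X₃) + volume (X₂ ∩ᵇ X₃)
  doubleCount-inclusionExclusion = begin
    doubleCount K₁ K₂ K₃ + 2 * volume (X₁ ∩ᵇ X₂ ∩ᵇ X₃)
      ≡⟨ cong₂ _+_ (length-filter≡sumBy (InTwo? K₁ K₂ K₃) allPoints)
                   (cong (2 *_) (sym (sumBy-𝟙ᵇ (X₁ ∩ᵇ X₂ ∩ᵇ X₃)))) ⟩
    sumBy χInTwo allPoints + 2 * sumBy (𝟙ᵇ (X₁ ∩ᵇ X₂ ∩ᵇ X₃)) allPoints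
      ≡⟨ cong (sumBy χInTwo allPoints +_) (sumBy-*ˡ 2 (𝟙ᵇ (X₁ ∩ᵇ X₂ ∩ᵇ X₃)) allPoints) ⟨
    sumBy χInTwo allPoints + sumBy (λ v → 2 * 𝟙ᵇ (X₁ ∩ᵇ X₂ ∩ᵇ X₃) v) allPoints
      ≡⟨ sumBy-+ χInTwo (λ v → 2 * 𝟙ᵇ (X₁ ∩ᵇ X₂ ∩ᵇ X₃) v) allPoints ⟨
    sumBy (λ v → χInTwo v + 2 * 𝟙ᵇ (X₁ ∩ᵇ X₂ ∩ᵇ X₃) v) allPoints
      ≡⟨ sumBy-cong χInTwo-inclusionExclusion allPoints ⟩
    sumBy (λ v → 𝟙ᵇ (X₁ ∩ᵇ X₂) v + 𝟙ᵇ (X₁ ∩ᵇ X₃) v + 𝟙ᵇ (X₂ ∩ᵇ X₃) v) allPoints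
      ≡⟨ sumBy-+ (λ v → 𝟙ᵇ (X₁ ∩ᵇ X₂) v + 𝟙ᵇ (X₁ ∩ᵇ X₃) v) (𝟙ᵇ (X₂ ∩ᵇ X₃)) allPoints ⟩
    sumBy (λ v → 𝟙ᵇ (X₁ ∩ᵇ X₂) v + 𝟙ᵇ (X₁ ∩ᵇ X₃) v) allPoints + sumBy (𝟙ᵇ (X₂ ∩ᵇ X₃)) allPoints
      ≡⟨ cong (_+ sumBy (𝟙ᵇ (X₂ ∩ᵇ X₃)) allPoints) (sumBy-+ (𝟙ᵇ (X₁ ∩ᵇ X₂)) (𝟙ᵇ (X₁ ∩ᵇ X₃)) allPoints) ⟩
    sumBy (𝟙ᵇ (X₁ ∩ᵇ X₂)) allPoints + sumBy (𝟙ᵇ (X₁ ∩ᵇ X₃)) allPoints + sumBy (𝟙ᵇ (X₂ ∩ᵇ X₃)) allPoints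
      ≡⟨ cong₂ _+_ (cong₂ _+_ (sumBy-𝟙ᵇ (X₁ ∩ᵇ X₂)) (sumBy-𝟙ᵇ (X₁ ∩ᵇ X₃)))
                   (sumBy-𝟙ᵇ (X₂ ∩ᵇ X₃)) ⟩
    volume (X₁ ∩ᵇ X₂) + volume (X₁ ∩ᵇ X₃) + volume (X₂ ∩ᵇ X₃)
      ∎

∁⊥≡⊤ : (n : ℕ) → ∁ (⊥ {n}) ≡ ⊤
∁⊥≡⊤ zero    = refl
∁⊥≡⊤ (suc n) = cong (inside ∷_) (∁⊥≡⊤ n)

∣p∣≡n⇒p≡∁⁅i⁆ : {n : ℕ} (p : Subset (suc n)) → ∣ p ∣ ≡ n → ∃[ i ] p ≡ ∁ ⁅ i ⁆
∣p∣≡n⇒p≡∁⁅i⁆ {n} (outside ∷ p) ∣p∣≡n = zero , cong (outside ∷_) (trans (∣p∣≡n⇒p≡⊤ ∣p∣≡n) (sym (∁⊥≡⊤ n)))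
∣p∣≡n⇒p≡∁⁅i⁆ {suc n} (inside ∷ p) ∣p∣≡n with ∣p∣≡n⇒p≡∁⁅i⁆ p (suc-injective ∣p∣≡n)
... | i , refl = suc i , refl

Overlaps : Set
Overlaps = ℕ × ℕ × ℕ × ℕ

overlaps : Subset 4 → Subset 4 → Subset 4 → Overlaps
overlaps p q r = ∣ p ∩ q ∣ , ∣ p ∩ r ∣ , ∣ q ∩ r ∣ , ∣ p ∩ q ∩ r ∣

_≟ₒ_ : DecidableEquality Overlaps
_≟ₒ_ = ≡-dec _≟_ (≡-dec _≟_ (≡-dec _≟_ _≟_))

open import Data.List.Membership.DecPropositional _≟ₒ_ using () renaming (_∈?_ to _∈ˡ?_)

-- Which of the three omitted coordinates coincide: none, all, or exactly one pair.
overlapPatterns : List Overlaps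
overlapPatterns =
  (2 , 2 , 2 , 1) ∷ (3 , 3 , 3 , 3) ∷ (3 , 2 , 2 , 2) ∷ (2 , 3 , 2 , 2) ∷ (2 , 2 , 3 , 2) ∷ []

overlaps-∁⁅⁆ : (i j k : Fin 4) → overlaps (∁ ⁅ i ⁆) (∁ ⁅ j ⁆) (∁ ⁅ k ⁆) ∈ˡ overlapPatterns
overlaps-∁⁅⁆ = from-yes (all? λ i → all? λ j → all? λ k →
  overlaps (∁ ⁅ i ⁆) (∁ ⁅ j ⁆) (∁ ⁅ k ⁆) ∈ˡ? overlapPatterns)

overlaps∈overlapPatterns : (p q r : Subset 4) → ∣ p ∣ ≡ 3 → ∣ q ∣ ≡ 3 → ∣ r ∣ ≡ 3 →
                           overlaps p q r ∈ˡ overlapPatterns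
overlaps∈overlapPatterns p q r ∣p∣≡3 ∣q∣≡3 ∣r∣≡3
  with ∣p∣≡n⇒p≡∁⁅i⁆ p ∣p∣≡3 | ∣p∣≡n⇒p≡∁⁅i⁆ q ∣q∣≡3 | ∣p∣≡n⇒p≡∁⁅i⁆ r ∣r∣≡3
... | i , refl | j , refl | k , refl = overlaps-∁⁅⁆ i j k

pairVolumes : Overlaps → Overlaps → Overlaps → ℕ
pairVolumes (a₁₂ , a₁₃ , a₂₃ , _) (b₁₂ , b₁₃ , b₂₃ , _) (c₁₂ , c₁₃ , c₂₃ , _) =
  a₁₂ * (b₁₂ * c₁₂) + a₁₃ * (b₁₃ * c₁₃) + a₂₃ * (b₂₃ * c₂₃)

tripleVolume : Overlaps → Overlaps → Overlaps → ℕ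
tripleVolume (_ , _ , _ , a₁₂₃) (_ , _ , _ , b₁₂₃) (_ , _ , _ , c₁₂₃) = a₁₂₃ * (b₁₂₃ * c₁₂₃)

overlapPatterns-bound : {a b c : Overlaps} →
  a ∈ˡ overlapPatterns → b ∈ˡ overlapPatterns → c ∈ˡ overlapPatterns →
  20 + 2 * tripleVolume a b c ≤ pairVolumes a b c
overlapPatterns-bound a∈ b∈ c∈ = All.lookup (All.lookup (All.lookup table a∈) b∈) c∈
  where
  table : All (λ a → All (λ b → All (λ c → 20 + 2 * tripleVolume a b c ≤ pairVolumes a b c)
            overlapPatterns) overlapPatterns) overlapPatterns
  table = from-yes (All.all? (λ a → All.all? (λ b → All.all? (λ c →
            20 + 2 * tripleVolume a b c ≤? pairVolumes a b c)
            overlapPatterns) overlapPatterns) overlapPatterns)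

mainTheorem9 : (K₁ K₂ K₃ : Cube) → 20 ≤ doubleCount K₁ K₂ K₃
mainTheorem9 K₁ K₂ K₃ =
  +-cancelʳ-≤ (2 * tripleVolume a b c) 20 (doubleCount K₁ K₂ K₃)
    (≤-trans (overlapPatterns-bound (axis A ∣A∣≡3) (axis B ∣B∣≡3) (axis C ∣C∣≡3))
             (≤-reflexive (sym (doubleCount-inclusionExclusion K₁ K₂ K₃))))
  where
  axis : (side : Cube → Subset 4) → (∀ K → ∣ side K ∣ ≡ 3) →
         overlaps (side K₁) (side K₂) (side K₃) ∈ˡ overlapPatterns
  axis side ∣side∣≡3 =
    overlaps∈overlapPatterns (side K₁) (side K₂) (side K₃) (∣side∣≡3 K₁) (∣side∣≡3 K₂) (∣side∣≡3 K₃)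
  a b c : Overlaps
  a = overlaps (A K₁) (A K₂) (A K₃)
  b = overlaps (B K₁) (B K₂) (B K₃)
  c = overlaps (C K₁) (C K₂) (C K₃)
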